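{- If $\phi$ is an automorphism of $\infty\mathbin{\hat{*}}I_\infty$ which fixes each maximal antichain setwise, then $\phi$ is the identity.
   Context: A digraph is an oriented simple graph; write $x\perp y$ if there is no edge between $x$ and $y$ (with $x\perp x$). A digraph is complete multipartite if $\perp$ is an equivalence relation; its classes are the maximal antichains. It has the parity property if for every two distinct maximal antichains $A,B$, every distinct $a,a'\in A$ and distinct $b,b'\in B$, the number of edges pointing from $\{a,a'\}$ to $\{b,b'\}$ is even. $\infty\mathbin{\hat{*}}I_\infty$ denotes the Fraïssé limit of the class of finite complete multipartite digraphs with the parity property, i.e. the countable homogeneous digraph whose finite induced substructures are exactly these finite digraphs. -}

module Defs where

open import Data.Bool using (Bool; true; false)
open import Data.Nat using (ℕ; zero; suc; _+_)
open import Data.Nat.Divisibility using (_∣_)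
open import Data.Fin using (Fin)
open import Data.Product using (Σ; _×_; ∃; ∃-syntax)
open import Relation.Nullary using (¬_)
open import Relation.Binary.PropositionalEquality using (_≡_)
open import Function.Definitions using (Injective)
open import Function.Bundles using (_↔_; Inverse)

-- A digraph on a vertex type V is given by its edge indicator:
-- e x y ≡ true  iff there is an edge pointing from x to y.
EdgeFn : Set → Set
EdgeFn V = V → V → Bool

Oriented : {V : Set} → EdgeFn V → Set
Oriented {V} e = (∀ x → e x x ≡ false) × (∀ x y → e x y ≡ true → e y x ≡ false)

Perp : {V : Set} → EdgeFn V → V → V → Set
Perp e x y = (e x y ≡ false) × (e y x ≡ false)

-- complete multipartite: ⊥ is an equivalence relation
-- (reflexive, symmetric and transitive)
CompleteMultipartite : {V : Set} → EdgeFn V → Set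
CompleteMultipartite {V} e =
  (∀ x → Perp e x x) × (∀ x y → Perp e x y → Perp e y x)
  × (∀ x y z → Perp e x y → Perp e y z → Perp e x z)

-- maximal antichains of a complete multipartite digraph are the ⊥-classes;
-- the maximal antichain containing a:
InAntichainOf : {V : Set} → EdgeFn V → V → V → Set
InAntichainOf e a x = Perp e a x

b2n : Bool → ℕ
b2n true = 1
b2n false = 0

edgesFromTo : {V : Set} → EdgeFn V → V → V → V → V → ℕ
edgesFromTo e a a' b b' = b2n (e a b) + b2n (e a b') + b2n (e a' b) + b2n (e a' b')

-- parity property: for a, a' distinct in one maximal antichain A and
-- b, b' distinct in another maximal antichain B ≠ A (i.e. a not ⊥ b),
-- the number of edges from {a,a'} to {b,b'} is even.
ParityProperty : {V : Set} → EdgeFn V → Set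
ParityProperty {V} e = ∀ a a' b b' → ¬ a ≡ a' → ¬ b ≡ b' →
  Perp e a a' → Perp e b b' → ¬ Perp e a b →
  2 ∣ edgesFromTo e a a' b b'

InClass : (n : ℕ) → EdgeFn (Fin n) → Set
InClass n d = Oriented d × CompleteMultipartite d × ParityProperty d

Induced : {n : ℕ} {V : Set} → EdgeFn V → (Fin n → V) → EdgeFn (Fin n)
Induced e f i j = e (f i) (f j)

IsAutomorphism : {V : Set} → EdgeFn V → V ↔ V → Set
IsAutomorphism e φ = ∀ x y → e (Inverse.to φ x) (Inverse.to φ y) ≡ e x y

-- e on ℕ (countably infinite vertex set) is the Fraïssé limit of the class:
--  * its age is exactly the class (every finite induced substructure lies in
--    the class, and every member of the class embeds as induced substructure)
--  * it is homogeneous (every isomorphism between finite induced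
--    substructures extends to an automorphism)
IsFraisseLimit : EdgeFn ℕ → Set
IsFraisseLimit e =
  (∀ n (f : Fin n → ℕ) → Injective _≡_ _≡_ f → InClass n (Induced e f))
  × (∀ n (d : EdgeFn (Fin n)) → InClass n d →
       ∃[ f ] (Injective _≡_ _≡_ f × (∀ i j → e (f i) (f j) ≡ d i j)))
  × (∀ n (f g : Fin n → ℕ) → Injective _≡_ _≡_ f → Injective _≡_ _≡_ g →
       (∀ i j → e (f i) (f j) ≡ e (g i) (g j)) →
       ∃[ φ ] (IsAutomorphism e φ × (∀ i → Inverse.to φ (f i) ≡ g i)))

FixesAntichainsSetwise : {V : Set} → EdgeFn V → V ↔ V → Set
FixesAntichainsSetwise {V} e φ = ∀ a →
  (∀ x → InAntichainOf e a x → InAntichainOf e a (Inverse.to φ x))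
  × (∀ x → InAntichainOf e a x → ∃[ y ] (InAntichainOf e a y × Inverse.to φ y ≡ x))

-- Suppose φ x ≠ x; then φ x lies in the antichain of x, and extension gives a third vertex z
-- of it.  Since every finite antichain with any prescribed edges into a new vertex embeds,
-- there is d with x → d, z → d, φ z → d and φ x ↛ d.  Applying φ, both φ x and φ z point to
-- φ d, and d ⊥ φ d because φ fixes the antichain of d.  So three of the four possible edges
-- from {φ z, φ x} to {d, φ d} are present, against the parity property.

module Submission where

open import Defs
open import Data.Bool using (Bool; true; false; not)
open import Data.Empty using (⊥; ⊥-elim)
open import Data.Fin using (Fin; zero; suc)
open import Data.Fin.Properties using (0≢1+n; suc-injective)
open import Data.Nat using (ℕ; suc; _≟_)
open import Data.Nat.Divisibility using (_∣_; n∣m⇒m%n≡0)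
open import Data.Product using (_×_; _,_; proj₁; proj₂; ∃-syntax)
open import Data.Vec.Functional using ([]; _∷_)
open import Function.Bundles using (_↔_; Inverse; Injection)
open import Function.Definitions using (Injective)
open import Function.Properties.Inverse using (↔⇒↣)
open import Relation.Nullary using (¬_; yes; no)
open import Relation.Nullary.Decidable using (decidable-stable)
open import Relation.Binary.PropositionalEquality
  using (_≡_; _≢_; refl; sym; trans; cong; subst; ≢-sym)

[]-injective : ∀ {A : Set} → Injective _≡_ _≡_ ([] {A = A})
[]-injective {x = ()}

cons-injective : ∀ {A : Set} {n} {f : Fin n → A} {v : A} →
  Injective _≡_ _≡_ f → (∀ i → f i ≢ v) → Injective _≡_ _≡_ (v ∷ f)
cons-injective f-inj fresh {zero}  {zero}  _  = refl
cons-injective f-inj fresh {zero}  {suc j} eq = ⊥-elim (fresh j (sym eq))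
cons-injective f-inj fresh {suc i} {zero}  eq = ⊥-elim (fresh i eq)
cons-injective f-inj fresh {suc i} {suc j} eq = cong suc (f-inj eq)

¬2∣3 : ¬ 2 ∣ 3
¬2∣3 2∣3 with () ← n∣m⇒m%n≡0 3 2 2∣3

module _ {V : Set} (e : EdgeFn V) where

  Edgeless : ∀ {n} → (Fin n → V) → Set
  Edgeless f = ∀ i j → e (f i) (f j) ≡ false

  edgeless-∷ : ∀ {n} {f : Fin n → V} {v} → Edgeless f → e v v ≡ false →
    (∀ i → Perp e (f i) v) → Edgeless (v ∷ f)
  edgeless-∷ f-edgeless loop perp zero    zero    = loop
  edgeless-∷ f-edgeless loop perp zero    (suc j) = proj₂ (perp j)
  edgeless-∷ f-edgeless loop perp (suc i) zero    = proj₁ (perp i)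
  edgeless-∷ f-edgeless loop perp (suc i) (suc j) = f-edgeless i j

  ≢-by-out-edge : ∀ {a b c} → e a c ≡ true → e b c ≡ false → a ≢ b
  ≢-by-out-edge ac bc refl with () ← trans (sym ac) bc

  ≢-by-in-edge : ∀ {a b c} → e c a ≡ true → e c b ≡ false → a ≢ b
  ≢-by-in-edge ca cb refl with () ← trans (sym ca) cb

  edge⇒¬perp : ∀ {a b} → e a b ≡ true → ¬ Perp e a b
  edge⇒¬perp ab (ab' , _) with () ← trans (sym ab) ab'

  odd-edge-count : ∀ {a a' b b'} → e a b ≡ true → e a b' ≡ true →
    e a' b ≡ false → e a' b' ≡ true → ¬ 2 ∣ edgesFromTo e a a' b b'
  odd-edge-count ab ab' a'b a'b' rewrite ab | ab' | a'b | a'b' = ¬2∣3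

discrete : ∀ {n} → EdgeFn (Fin n)
discrete _ _ = false

discrete-∈-class : ∀ n → InClass n discrete
discrete-∈-class n =
  ((λ _ → refl) , λ _ _ ())
  , ((λ _ → refl , refl) , (λ _ _ _ → refl , refl) , λ _ _ _ _ _ → refl , refl)
  , λ _ _ _ _ _ _ _ _ ¬perp → ⊥-elim (¬perp (refl , refl))

-- Vertex zero is the centre and suc i the leaves: leaf i → centre iff p i, and otherwise
-- centre → leaf i, so the centre forms an antichain of its own.
star : ∀ {n} → (Fin n → Bool) → EdgeFn (Fin (suc n))
star p zero    zero    = false
star p zero    (suc j) = not (p j)
star p (suc i) zero    = p i
star p (suc i) (suc j) = false

module _ {n : ℕ} (p : Fin n → Bool) where

  centre-¬⊥-leaf : ∀ j → ¬ Perp (star p) zero (suc j)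
  centre-¬⊥-leaf j perp with p j | perp
  ... | false | () , _
  ... | true  | _ , ()

  leaf-¬⊥-centre : ∀ i → ¬ Perp (star p) (suc i) zero
  leaf-¬⊥-centre i (ic , ci) = centre-¬⊥-leaf i (ci , ic)

  star-perp-refl : ∀ x → Perp (star p) x x
  star-perp-refl zero    = refl , refl
  star-perp-refl (suc i) = refl , refl

  star-asym : ∀ x y → star p x y ≡ true → star p y x ≡ false
  star-asym zero    (suc j) xy with p j | xy
  ... | false | _ = refl
  star-asym (suc i) zero    xy with p i | xy
  ... | true  | _ = refl

  star-perp-trans : ∀ x y z → Perp (star p) x y → Perp (star p) y z → Perp (star p) x z
  star-perp-trans zero    zero    zero    _  _  = refl , refl
  star-perp-trans zero    zero    (suc k) _  yz = ⊥-elim (centre-¬⊥-leaf k yz)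
  star-perp-trans zero    (suc j) _       xy _  = ⊥-elim (centre-¬⊥-leaf j xy)
  star-perp-trans (suc i) zero    _       xy _  = ⊥-elim (leaf-¬⊥-centre i xy)
  star-perp-trans (suc i) (suc j) zero    _  yz = ⊥-elim (leaf-¬⊥-centre j yz)
  star-perp-trans (suc i) (suc j) (suc k) _  _  = refl , refl

  -- Distinct ⊥-related vertices are leaves, and any two leaves are ⊥-related.
  star-parity : ParityProperty (star p)
  star-parity zero    zero    _       _       a≢a' = ⊥-elim (a≢a' refl)
  star-parity zero    (suc j) _       _       _ _ aa' = ⊥-elim (centre-¬⊥-leaf j aa')
  star-parity (suc i) zero    _       _       _ _ aa' = ⊥-elim (leaf-¬⊥-centre i aa')
  star-parity (suc i) (suc j) zero    zero    _ b≢b' = ⊥-elim (b≢b' refl)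
  star-parity (suc i) (suc j) zero    (suc l) _ _ _ bb' = ⊥-elim (centre-¬⊥-leaf l bb')
  star-parity (suc i) (suc j) (suc k) zero    _ _ _ bb' = ⊥-elim (leaf-¬⊥-centre k bb')
  star-parity (suc i) (suc j) (suc k) (suc l) _ _ _ _ ¬ab = ⊥-elim (¬ab (refl , refl))

  star-∈-class : InClass (suc n) (star p)
  star-∈-class =
    ((λ x → proj₁ (star-perp-refl x)) , star-asym)
    , (star-perp-refl , (λ _ _ xy → proj₂ xy , proj₁ xy) , star-perp-trans)
    , star-parity

module FraisseLimit (e : EdgeFn ℕ) (limit : IsFraisseLimit e) where

  age⊆class : ∀ n (f : Fin n → ℕ) → Injective _≡_ _≡_ f → InClass n (Induced e f)
  age⊆class = proj₁ limit

  class⊆age : ∀ n (d : EdgeFn (Fin n)) → InClass n d →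
    ∃[ f ] (Injective _≡_ _≡_ f × (∀ i j → e (f i) (f j) ≡ d i j))
  class⊆age = proj₁ (proj₂ limit)

  homogeneous : ∀ n (f g : Fin n → ℕ) → Injective _≡_ _≡_ f → Injective _≡_ _≡_ g →
    (∀ i j → e (f i) (f j) ≡ e (g i) (g j)) →
    ∃[ ψ ] (IsAutomorphism e ψ × (∀ i → Inverse.to ψ (f i) ≡ g i))
  homogeneous = proj₂ (proj₂ limit)

  loopless : ∀ v → e v v ≡ false
  loopless v = proj₁ (proj₁ (age⊆class 1 (v ∷ []) (cons-injective []-injective λ ()))) zero

  edge⇒≢ : ∀ {a b} → e a b ≡ true → a ≢ b
  edge⇒≢ {a} ab refl with () ← trans (sym ab) (loopless a)

  extension-property : ∀ {n} (D : EdgeFn (Fin (suc n))) → InClass (suc n) D →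
    (f : Fin n → ℕ) → Injective _≡_ _≡_ f → (∀ i j → e (f i) (f j) ≡ D (suc i) (suc j)) →
    ∃[ v ] ((∀ i → f i ≢ v) × (∀ i → e (f i) v ≡ D (suc i) zero)
                             × (∀ i → e v (f i) ≡ D zero (suc i)))
  extension-property {n} D D∈class f f-inj f≅D with class⊆age (suc n) D D∈class
  ... | g , g-inj , g≅D
    with homogeneous n (λ i → g (suc i)) f (λ eq → suc-injective (g-inj eq)) f-inj
           (λ i j → trans (g≅D (suc i) (suc j)) (sym (f≅D i j)))
  ... | ψ , ψ-aut , ψg≡f = v , fresh , into , out-of
    where
    v : ℕ
    v = Inverse.to ψ (g zero)

    image : ∀ a b → e (Inverse.to ψ (g a)) (Inverse.to ψ (g b)) ≡ D a b
    image a b = trans (ψ-aut (g a) (g b)) (g≅D a b)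

    fresh : ∀ i → f i ≢ v
    fresh i eq = 0≢1+n (sym (g-inj (Injection.injective (↔⇒↣ ψ) (trans (ψg≡f i) eq))))

    into : ∀ i → e (f i) v ≡ D (suc i) zero
    into i = subst (λ w → e w v ≡ D (suc i) zero) (ψg≡f i) (image (suc i) zero)

    out-of : ∀ i → e v (f i) ≡ D zero (suc i)
    out-of i = subst (λ w → e v w ≡ D zero (suc i)) (ψg≡f i) (image zero (suc i))

  IsAntichain : ∀ {n} → (Fin n → ℕ) → Set
  IsAntichain f = Injective _≡_ _≡_ f × Edgeless e f

  antichain-∷ : ∀ {n} {f : Fin n → ℕ} {v} → IsAntichain f →
    (∀ i → f i ≢ v) → (∀ i → Perp e (f i) v) → IsAntichain (v ∷ f)
  antichain-∷ {v = v} (f-inj , f-edgeless) fresh perp =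
    cons-injective f-inj fresh , edgeless-∷ e f-edgeless (loopless v) perp

  singleton-antichain : ∀ v → IsAntichain (v ∷ [])
  singleton-antichain v = antichain-∷ ([]-injective , λ ()) (λ ()) (λ ())

  antichain-extension : ∀ {n} {f : Fin n → ℕ} → IsAntichain f →
    ∃[ v ] ((∀ i → f i ≢ v) × (∀ i → Perp e (f i) v))
  antichain-extension {n} {f} (f-inj , f-edgeless)
    with extension-property discrete (discrete-∈-class (suc n)) f f-inj f-edgeless
  ... | v , fresh , into , out-of = v , fresh , λ i → into i , out-of i

  edge-pattern-realised : ∀ {n} {f : Fin n → ℕ} → IsAntichain f → (p : Fin n → Bool) →
    ∃[ d ] (∀ i → e (f i) d ≡ p i)
  edge-pattern-realised {f = f} (f-inj , f-edgeless) p
    with extension-property (star p) (star-∈-class p) f f-inj f-edgeless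
  ... | d , _ , into , _ = d , into

  three-edges-impossible : ∀ {a a' b b'} → Perp e a a' → Perp e b b' →
    e a b ≡ true → e a b' ≡ true → e a' b ≡ false → e a' b' ≡ true → ⊥
  three-edges-impossible {a} {a'} {b} {b'} aa' bb' ab ab' a'b a'b' =
    odd-edge-count e ab ab' a'b a'b'
      (proj₂ (proj₂ (age⊆class 4 (a ∷ a' ∷ b ∷ b' ∷ []) quadruple-injective))
        zero (suc zero) (suc (suc zero)) (suc (suc (suc zero)))
        (λ ()) (λ ()) aa' bb' (edge⇒¬perp e ab))
    where
    quadruple-injective : Injective _≡_ _≡_ (a ∷ a' ∷ b ∷ b' ∷ [])
    quadruple-injective =
      cons-injective
        (cons-injective
          (cons-injective (cons-injective []-injective λ ())
            λ { zero → ≢-by-in-edge e a'b' a'b ; (suc ()) })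
          λ { zero → ≢-by-in-edge e ab (proj₁ aa')
            ; (suc zero) → ≢-sym (edge⇒≢ a'b')
            ; (suc (suc ())) })
        λ { zero → ≢-sym (≢-by-out-edge e ab a'b)
          ; (suc zero) → ≢-sym (edge⇒≢ ab)
          ; (suc (suc zero)) → ≢-sym (edge⇒≢ ab')
          ; (suc (suc (suc ()))) }

  module AntichainFixing (φ : ℕ ↔ ℕ) (φ-aut : IsAutomorphism e φ)
                         (φ-fixes : FixesAntichainsSetwise e φ) where

    open Inverse φ using (to)

    to-preserves-≢ : ∀ {a b} → a ≢ b → to a ≢ to b
    to-preserves-≢ a≢b eq = a≢b (Injection.injective (↔⇒↣ φ) eq)

    perp-image : ∀ {a b} → Perp e a b → Perp e (to a) (to b)
    perp-image {a} {b} (ab , ba) = trans (φ-aut a b) ab , trans (φ-aut b a) ba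

    perp-to : ∀ {a v} → Perp e a v → Perp e a (to v)
    perp-to {a} {v} = proj₁ (φ-fixes a) v

    perp-self : ∀ a → Perp e a (to a)
    perp-self a = perp-to (loopless a , loopless a)

    no-separating-vertex : ∀ {x z d} → Perp e x z → e x d ≡ true → e z d ≡ true →
      e (to z) d ≡ true → e (to x) d ≡ false → ⊥
    no-separating-vertex {x} {z} {d} (xz , zx) xd zd φz→d φx↛d =
      three-edges-impossible (perp-image (zx , xz)) (perp-self d)
        φz→d (trans (φ-aut z d) zd) φx↛d (trans (φ-aut x d) xd)

    antichain-with-image : ∀ {x z} → IsAntichain (z ∷ to x ∷ x ∷ []) → to z ≢ z → to z ≢ x →
      IsAntichain (to z ∷ z ∷ to x ∷ x ∷ [])
    antichain-with-image {x} {z} A@(z-inj , z-edgeless) φz≢z φz≢x = antichain-∷ A fresh perp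
      where
      x⊥z : Perp e x z
      x⊥z = z-edgeless (suc (suc zero)) zero , z-edgeless zero (suc (suc zero))

      fresh : ∀ i → (z ∷ to x ∷ x ∷ []) i ≢ to z
      fresh zero             = ≢-sym φz≢z
      fresh (suc zero)       =
        to-preserves-≢ λ x≡z → 0≢1+n (z-inj {zero} {suc (suc zero)} (sym x≡z))
      fresh (suc (suc zero)) = ≢-sym φz≢x

      perp : ∀ i → Perp e ((z ∷ to x ∷ x ∷ []) i) (to z)
      perp zero             = perp-self z
      perp (suc zero)       = perp-image x⊥z
      perp (suc (suc zero)) = perp-to x⊥z

    separating-vertex-via : ∀ {x z} → IsAntichain (z ∷ to x ∷ x ∷ []) →
      (∀ {d} → e z d ≡ true → e x d ≡ true → e (to z) d ≡ true) →
      ∃[ d ] (e x d ≡ true × e z d ≡ true × e (to z) d ≡ true × e (to x) d ≡ false)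
    separating-vertex-via A φz-edge with edge-pattern-realised A (true ∷ false ∷ true ∷ [])
    ... | d , d-edges = d , d-edges (suc (suc zero)) , d-edges zero
                          , φz-edge (d-edges zero) (d-edges (suc (suc zero))) , d-edges (suc zero)

    -- If φ z is z or x, its edge to d is already prescribed by the pattern on z, φ x, x.
    separating-vertex : ∀ {x z} → IsAntichain (z ∷ to x ∷ x ∷ []) →
      ∃[ d ] (e x d ≡ true × e z d ≡ true × e (to z) d ≡ true × e (to x) d ≡ false)
    separating-vertex {x} {z} A with to z ≟ z | to z ≟ x
    ... | yes φz≡z | _        =
      separating-vertex-via A (λ zd _ → subst (λ w → e w _ ≡ true) (sym φz≡z) zd)
    ... | no _     | yes φz≡x =
      separating-vertex-via A (λ _ xd → subst (λ w → e w _ ≡ true) (sym φz≡x) xd)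
    ... | no φz≢z  | no φz≢x
      with edge-pattern-realised (antichain-with-image A φz≢z φz≢x) (true ∷ true ∷ false ∷ true ∷ [])
    ...   | d , d-edges = d , d-edges (suc (suc (suc zero))) , d-edges (suc zero)
                            , d-edges zero , d-edges (suc (suc zero))

    antichain-with-moved : ∀ {x} → to x ≢ x → IsAntichain (to x ∷ x ∷ [])
    antichain-with-moved {x} φx≢x =
      antichain-∷ (singleton-antichain x) (λ { zero → ≢-sym φx≢x }) (λ { zero → perp-self x })

    moved-vertex-impossible : ∀ x → ¬ to x ≢ x
    moved-vertex-impossible x φx≢x with antichain-extension (antichain-with-moved φx≢x)
    ... | z , z-fresh , z-perp
      with separating-vertex (antichain-∷ (antichain-with-moved φx≢x) z-fresh z-perp)
    ... | d , xd , zd , φzd , φxd = no-separating-vertex (z-perp (suc zero)) xd zd φzd φxd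

proposition4p3 : (e : EdgeFn ℕ) → IsFraisseLimit e → (φ : ℕ ↔ ℕ) →
    IsAutomorphism e φ → FixesAntichainsSetwise e φ →
    ∀ x → Inverse.to φ x ≡ x
proposition4p3 e limit φ φ-aut φ-fixes x =
  decidable-stable (Inverse.to φ x ≟ x)
    (FraisseLimit.AntichainFixing.moved-vertex-impossible e limit φ φ-aut φ-fixes x)
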